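{- Let $n\ge 3$, let $a,b\in\mathbb{C}$ with $b\neq 0$, and let $J_n$ be the $n\times n$ exchange matrix ($(J_n)_{i,j}=1$ if $i+j=n+1$ and $0$ otherwise). Let $\widetilde{A}_n$ be the $n\times n$ tridiagonal matrix with all diagonal entries equal to $a$, with $(\widetilde{A}_n)_{1,2}=(\widetilde{A}_n)_{n,n-1}=2b$, $(\widetilde{A}_n)_{2,1}=(\widetilde{A}_n)_{n-1,n}=b$, all other entries on the sub- and superdiagonal equal to $-b$, and all remaining entries $0$. Let $A_n:=J_n\widetilde{A}_n$, i.e. $A_n$ is the anti-tridiagonal matrix with $(A_n)_{i,n+1-i}=a$ for all $i$, $(A_n)_{1,n-1}=(A_n)_{n,2}=2b$, $(A_n)_{2,n}=(A_n)_{n-1,1}=b$, all other entries $(A_n)_{i,j}$ with $|i+j-(n+1)|=1$ equal to $-b$, and all remaining entries $0$. Then for every positive integer $r$, $$A_n^{r}=\begin{cases} J_n\widetilde{A}_n^{\,r}, & r \text{ odd},\\ \widetilde{A}_n^{\,r}, & r\text{ even}.\end{cases}$$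
   Context: $A_n^r$ denotes the $r$-th matrix power. The anti-tridiagonal matrix $A_n$ is the one the paper displays; the description via $J_n\widetilde{A}_n$ is equivalent to its displayed form. -}

module Defs where

open import Level using (Level)
open import Algebra.Bundles using (CommutativeRing)
open import Data.Nat as ℕ using (ℕ; zero; suc)
open import Data.Fin using (Fin; toℕ)
open import Data.Bool using (Bool; true; false; if_then_else_; _∧_; _∨_)
open import Relation.Nullary.Decidable using (⌊_⌋)

-- Square matrices over a commutative ring R, entries indexed by Fin n (0-based;
-- the paper's 1-based index i corresponds to toℕ i + 1).
module MatrixDefs {c ℓ : Level} (R : CommutativeRing c ℓ) where
  open CommutativeRing R

  Mat : ℕ → Set c
  Mat n = Fin n → Fin n → Carrier

  ∑ : ∀ {n} → (Fin n → Carrier) → Carrier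
  ∑ {zero}  f = 0#
  ∑ {suc n} f = f Fin.zero + ∑ (λ i → f (Fin.suc i))


  _⊗_ : ∀ {n} → Mat n → Mat n → Mat n
  (M ⊗ N) i j = ∑ (λ k → M i k * N k j)

  identity : ∀ {n} → Mat n
  identity i j = if ⌊ toℕ i ℕ.≟ toℕ j ⌋ then 1# else 0#

  _^_ : ∀ {n} → Mat n → ℕ → Mat n
  M ^ zero  = identity
  M ^ suc r = M ⊗ (M ^ r)

  _==_ : ℕ → ℕ → Bool
  x == y = ⌊ x ℕ.≟ y ⌋

  J : (n : ℕ) → Mat n
  J n i j = if (suc (toℕ i) ℕ.+ suc (toℕ j)) == suc n then 1# else 0#

  Ãentry : (n : ℕ) (a b : Carrier) → ℕ → ℕ → Carrier
  Ãentry n a b p q =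
    if p == q then a
    else if (p == 1 ∧ q == 2) ∨ (p == n ∧ suc q == n) then b + b
    else if (p == 2 ∧ q == 1) ∨ (suc p == n ∧ q == n) then b
    else if (suc p == q) ∨ (p == suc q) then - b
    else 0#

  Ã : (n : ℕ) (a b : Carrier) → Mat n
  Ã n a b i j = Ãentry n a b (suc (toℕ i)) (suc (toℕ j))

  Aentry : (n : ℕ) (a b : Carrier) → ℕ → ℕ → Carrier
  Aentry n a b p q =
    if (p ℕ.+ q) == suc n then a
    else if (p == 1 ∧ suc q == n) ∨ (p == n ∧ q == 2) then b + b
    else if (p == 2 ∧ q == n) ∨ (suc p == n ∧ q == 1) then b
    else if (p ℕ.+ q) == n ∨ (p ℕ.+ q) == suc (suc n) then - b
    else 0#

  A : (n : ℕ) (a b : Carrier) → Mat n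
  A n a b i j = Aentry n a b (suc (toℕ i)) (suc (toℕ j))

module Submission where

-- A_n is the exchange matrix J_n times the tridiagonal matrix Ã_n, and
-- since Ã_n is persymmetric it is also Ã_n J_n.  Entrywise, with opposite i the
-- index mirrored about the centre,
--     A i j = Ã (opposite i) j     and     A i j = Ã i (opposite j).
-- From these two identities alone the power formula follows by induction:
-- M^{r+1} = (J N) N^r = J N^{r+1} when M^r = N^r, and
-- M^{r+1} = (N J)(J N^r) = N^{r+1} when M^r = J N^r, since J² = I.

open import Defs
open import Level using (Level)
open import Algebra.Bundles using (CommutativeRing)
open import Data.Nat using (ℕ; _≤_; _%_)
open import Data.Fin using (Fin)
open import Data.Product using (_×_)
open import Relation.Nullary using (¬_)
open import Relation.Binary.PropositionalEquality using (_≡_)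

open import Data.Nat as ℕ using (zero; suc; _+_; _∸_)
open import Data.Nat.Properties using (+-cancelˡ-≡; +-cancelʳ-≡; +-suc; suc-injective; m+[n∸m]≡n)
open import Data.Nat.Tactic.RingSolver using (solve)
open import Data.Fin as Fin using (toℕ; opposite; punchIn)
open import Data.Fin.Properties using (toℕ<n; toℕ-injective; opposite-prop; punchInᵢ≢i)
import Data.Fin.Permutation as Permutation
open import Data.Bool using (Bool; true; false; if_then_else_; _∧_; _∨_)
open import Data.Bool.Properties using (∨-comm)
open import Data.Product using (_,_; proj₁; proj₂)
open import Data.List using (_∷_; [])
open import Data.Vec.Functional using (removeAt; replicate)
open import Relation.Nullary.Decidable using (yes; no; isYes≗does; dec-true; dec-false)
open import Relation.Binary.PropositionalEquality using (refl; sym; trans; cong; cong₂; _≢_; module ≡-Reasoning)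
import Algebra.Properties.Semiring.Sum as SemiringSum

opposite-complement : ∀ {n} (i : Fin n) → toℕ i + suc (toℕ (opposite i)) ≡ n
opposite-complement {n} i = begin
  toℕ i + suc (toℕ (opposite i))     ≡⟨ +-suc (toℕ i) (toℕ (opposite i)) ⟩
  suc (toℕ i + toℕ (opposite i))     ≡⟨ cong (λ k → suc (toℕ i + k)) (opposite-prop i) ⟩
  suc (toℕ i) + (n ∸ suc (toℕ i))    ≡⟨ m+[n∸m]≡n (toℕ<n i) ⟩
  n                                  ∎
  where open ≡-Reasoning

opposite-unique : ∀ {n} (i k : Fin n) → toℕ i + suc (toℕ k) ≡ n → k ≡ opposite i
opposite-unique i k complement = toℕ-injective (suc-injective
  (+-cancelˡ-≡ (toℕ i) _ _ (trans complement (sym (opposite-complement i)))))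

module MatrixFacts {c ℓ : Level} (R : CommutativeRing c ℓ) where
  open CommutativeRing R hiding (sym; trans) renaming (_+_ to _⊕_; refl to ≈-refl)
  open MatrixDefs R
  open SemiringSum semiring using (sum; sum-cong-≋; sum-remove; sum-replicate-zero; ∑-permute)
  open import Relation.Binary.Reasoning.Setoid setoid

  ==-true : ∀ {x y} → x ≡ y → (x == y) ≡ true
  ==-true {x} {y} x≡y = trans (isYes≗does (x ℕ.≟ y)) (dec-true (x ℕ.≟ y) x≡y)

  ==-false : ∀ {x y} → x ≢ y → (x == y) ≡ false
  ==-false {x} {y} x≢y = trans (isYes≗does (x ℕ.≟ y)) (dec-false (x ℕ.≟ y) x≢y)

  ==-cong : ∀ {x y u v} → (x ≡ y → u ≡ v) → (u ≡ v → x ≡ y) → (x == y) ≡ (u == v)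
  ==-cong {x} {y} {u} {v} to from with u ℕ.≟ v
  ... | yes u≡v = ==-true (from u≡v)
  ... | no u≢v = ==-false (λ x≡y → u≢v (to x≡y))

  ==-translate : ∀ x y u v → x + v ≡ y + u → (x == y) ≡ (u == v)
  ==-translate x y u v balance = ==-cong
    (λ { refl → sym (+-cancelˡ-≡ x v u balance) })
    (λ { refl → +-cancelʳ-≡ u x y balance })

  ==-reflect : ∀ x y u v → x + u ≡ y + v → (x == y) ≡ (u == v)
  ==-reflect x y u v balance = ==-cong
    (λ { refl → +-cancelˡ-≡ x u v balance })
    (λ { refl → +-cancelʳ-≡ u x y balance })

  -- Both A and Ã are defined by the same four-way case distinction; only the
  -- four tests differ.
  select : (a b : Carrier) → Bool → Bool → Bool → Bool → Carrier
  select a b c₁ c₂ c₃ c₄ =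
    if c₁ then a else if c₂ then b ⊕ b else if c₃ then b else if c₄ then - b else 0#

  select-cong : ∀ {a b c₁ c₂ c₃ c₄ d₁ d₂ d₃ d₄} →
    c₁ ≡ d₁ → c₂ ≡ d₂ → c₃ ≡ d₃ → c₄ ≡ d₄ → select a b c₁ c₂ c₃ c₄ ≡ select a b d₁ d₂ d₃ d₄
  select-cong refl refl refl refl = refl

  -- Row mirroring: row p = i + 1 of A is row p' of Ã, where p + p' = n + 1.
  -- The tests on p in A become the corresponding tests on p' in Ã, the two
  -- disjuncts of each of the last three tests trading places.
  A-row-mirror : ∀ {n} a b i p' q → i + p' ≡ n →
    Aentry n a b (suc i) q ≡ Ãentry n a b p' q
  A-row-mirror a b i p' q refl = select-cong
    (==-reflect (suc i + q) (suc (i + p')) p' q (solve (i ∷ p' ∷ q ∷ [])))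
    (swapped (==-reflect (suc i) 1 p' (i + p') (solve (i ∷ p' ∷ [])))
             (==-reflect (suc i) (i + p') p' 1 (solve (i ∷ p' ∷ []))))
    (swapped (==-reflect (suc i) 2 (suc p') (i + p') (solve (i ∷ p' ∷ [])))
             (==-reflect (suc (suc i)) (i + p') p' 2 (solve (i ∷ p' ∷ []))))
    (trans (cong₂ _∨_ (==-reflect (suc i + q) (i + p') p' (suc q) (solve (i ∷ p' ∷ q ∷ [])))
                      (==-reflect (suc i + q) (suc (suc (i + p'))) (suc p') q (solve (i ∷ p' ∷ q ∷ []))))
           (∨-comm (p' == suc q) (suc p' == q)))
    where
    swapped : ∀ {x x' y z z' w : Bool} → x ≡ x' → z ≡ z' → (x ∧ y) ∨ (z ∧ w) ≡ (z' ∧ w) ∨ (x' ∧ y)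
    swapped {x} {y = y} {z} {w = w} refl refl = ∨-comm (x ∧ y) (z ∧ w)

  -- Column mirroring: column q = j + 1 of A is column q' of Ã, where
  -- q + q' = n + 1.  Here every test keeps its position.
  A-column-mirror : ∀ {n} a b p j q' → j + q' ≡ n →
    Aentry n a b p (suc j) ≡ Ãentry n a b p q'
  A-column-mirror a b p j q' refl = select-cong
    (==-translate (p + suc j) (suc (j + q')) p q' (solve (p ∷ j ∷ q' ∷ [])))
    (cong₂ _∨_ (cong ((p == 1) ∧_) (==-reflect (suc (suc j)) (j + q') q' 2 (solve (j ∷ q' ∷ []))))
               (cong ((p == (j + q')) ∧_) (==-reflect (suc j) 2 (suc q') (j + q') (solve (j ∷ q' ∷ [])))))
    (cong₂ _∨_ (cong ((p == 2) ∧_) (==-reflect (suc j) (j + q') q' 1 (solve (j ∷ q' ∷ []))))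
               (cong ((suc p == (j + q')) ∧_) (==-reflect (suc j) 1 q' (j + q') (solve (j ∷ q' ∷ [])))))
    (cong₂ _∨_ (==-translate (p + suc j) (j + q') (suc p) q' (solve (p ∷ j ∷ q' ∷ [])))
               (==-translate (p + suc j) (suc (suc (j + q'))) p (suc q') (solve (p ∷ j ∷ q' ∷ []))))

  A-rows : ∀ n a b (i j : Fin n) → A n a b i j ≡ Ã n a b (opposite i) j
  A-rows n a b i j =
    A-row-mirror a b (toℕ i) (suc (toℕ (opposite i))) (suc (toℕ j)) (opposite-complement i)

  A-columns : ∀ n a b (i j : Fin n) → A n a b i j ≡ Ã n a b i (opposite j)
  A-columns n a b i j =
    A-column-mirror a b (suc (toℕ i)) (toℕ j) (suc (toℕ (opposite j))) (opposite-complement j)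

  ∑≡sum : ∀ {n} (f : Fin n → Carrier) → ∑ f ≡ sum f
  ∑≡sum {zero}  f = refl
  ∑≡sum {suc n} f = cong (f Fin.zero ⊕_) (∑≡sum (λ k → f (Fin.suc k)))

  ∑-cong : ∀ {n} {f g : Fin n → Carrier} → (∀ k → f k ≈ g k) → ∑ f ≈ ∑ g
  ∑-cong {f = f} {g} f≈g = begin
    ∑ f    ≡⟨ ∑≡sum f ⟩
    sum f  ≈⟨ sum-cong-≋ f≈g ⟩
    sum g  ≡⟨ ∑≡sum g ⟨
    ∑ g    ∎

  ∑-mirror : ∀ {n} (f : Fin n → Carrier) → ∑ (λ k → f (opposite k)) ≈ ∑ f
  ∑-mirror f = begin
    ∑ (λ k → f (opposite k))    ≡⟨ ∑≡sum (λ k → f (opposite k)) ⟩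
    sum (λ k → f (opposite k))  ≈⟨ ∑-permute f Permutation.reverse ⟨
    sum f                       ≡⟨ ∑≡sum f ⟨
    ∑ f                         ∎

  ∑-single : ∀ {n} (f : Fin n → Carrier) k₀ → (∀ k → k ≢ k₀ → f k ≈ 0#) → ∑ f ≈ f k₀
  ∑-single {suc n} f k₀ vanishes = begin
    ∑ f                          ≡⟨ ∑≡sum f ⟩
    sum f                        ≈⟨ sum-remove f ⟩
    f k₀ ⊕ sum (removeAt f k₀)   ≈⟨ +-congˡ (sum-cong-≋ (λ k → vanishes (punchIn k₀ k) (punchInᵢ≢i k₀ k))) ⟩
    f k₀ ⊕ sum (replicate n 0#)  ≈⟨ +-congˡ (sum-replicate-zero n) ⟩
    f k₀ ⊕ 0#                    ≈⟨ +-identityʳ (f k₀) ⟩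
    f k₀                         ∎

  J-mirrors-rows : ∀ n (X : Mat n) i j → (J n ⊗ X) i j ≈ X (opposite i) j
  J-mirrors-rows n X i j = begin
    (J n ⊗ X) i j                      ≈⟨ ∑-single (λ k → J n i k * X k j) (opposite i) off-anti-diagonal ⟩
    J n i (opposite i) * X (opposite i) j
      ≡⟨ cong (λ t → (if t then 1# else 0#) * X (opposite i) j) (==-true (cong suc (opposite-complement i))) ⟩
    1# * X (opposite i) j              ≈⟨ *-identityˡ (X (opposite i) j) ⟩
    X (opposite i) j                   ∎
    where
    off-anti-diagonal : ∀ k → k ≢ opposite i → J n i k * X k j ≈ 0#
    off-anti-diagonal k k≢ = begin
      J n i k * X k j  ≡⟨ cong (λ t → (if t then 1# else 0#) * X k j)
                              (==-false (λ sums → k≢ (opposite-unique i k (suc-injective sums)))) ⟩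
      0# * X k j       ≈⟨ zeroˡ (X k j) ⟩
      0#               ∎

  module MirroredPowers {n} (M N : Mat n)
      (M-rows : ∀ i j → M i j ≈ N (opposite i) j)
      (M-columns : ∀ i j → M i j ≈ N i (opposite j)) where

    Agrees : ℕ → Set ℓ
    Agrees r = ∀ i j → (M ^ r) i j ≈ (N ^ r) i j

    AgreesMirrored : ℕ → Set ℓ
    AgreesMirrored r = ∀ i j → (M ^ r) i j ≈ (N ^ r) (opposite i) j

    -- M^{r+1} = (J N) N^r = J N^{r+1}.
    agrees⇒mirrored : ∀ {r} → Agrees r → AgreesMirrored (suc r)
    agrees⇒mirrored agrees i j = ∑-cong (λ k → *-cong (M-rows i k) (agrees k j))

    -- M^{r+1} = (N J)(J N^r) = N^{r+1}, the two mirrorings cancelling in the sum.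
    mirrored⇒agrees : ∀ {r} → AgreesMirrored r → Agrees (suc r)
    mirrored⇒agrees {r} mirrored i j = begin
      (M ^ suc r) i j                                       ≈⟨ ∑-cong (λ k → *-cong (M-columns i k) (mirrored k j)) ⟩
      ∑ (λ k → N i (opposite k) * (N ^ r) (opposite k) j)  ≈⟨ ∑-mirror (λ k → N i k * (N ^ r) k j) ⟩
      (N ^ suc r) i j                                       ∎

    -- Two steps at a time, so that (r + 2) % 2 reduces to r % 2.
    parity-powers : ∀ r → (r % 2 ≡ 1 → AgreesMirrored r) × (r % 2 ≡ 0 → Agrees r)
    parity-powers zero          = (λ ()) , (λ _ i j → ≈-refl)
    parity-powers (suc zero)    = (λ _ → agrees⇒mirrored {0} (λ i j → ≈-refl)) , (λ ())
    parity-powers (suc (suc r)) =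
      (λ odd → agrees⇒mirrored {suc r} (mirrored⇒agrees {r} (proj₁ (parity-powers r) odd))) ,
      (λ even → mirrored⇒agrees {suc r} (agrees⇒mirrored {r} (proj₂ (parity-powers r) even)))

lemma2 : ∀ {c ℓ : Level} (R : CommutativeRing c ℓ) →
  let open CommutativeRing R
      open MatrixDefs R
  in (n : ℕ) → 3 ≤ n → (a b : Carrier) → ¬ (b ≈ 0#) →
     (r : ℕ) → 1 ≤ r →
     (r % 2 ≡ 1 → ∀ (i j : Fin n) → (A n a b ^ r) i j ≈ (J n ⊗ (Ã n a b ^ r)) i j)
     × (r % 2 ≡ 0 → ∀ (i j : Fin n) → (A n a b ^ r) i j ≈ (Ã n a b ^ r) i j)
lemma2 R n _ a b _ r _ =
  (λ odd i j → ≈-trans (proj₁ (parity-powers r) odd i j) (≈-sym (J-mirrors-rows n (Ã n a b ^ r) i j))) ,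
  proj₂ (parity-powers r)
  where
  open CommutativeRing R using (reflexive) renaming (trans to ≈-trans; sym to ≈-sym)
  open MatrixDefs R
  open MatrixFacts R
  open MirroredPowers (A n a b) (Ã n a b)
    (λ i j → reflexive (A-rows n a b i j)) (λ i j → reflexive (A-columns n a b i j))
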